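{- Let $k\geq 2$. Let $S^{(k)}$ be the graph with vertices $v_0,\dots,v_{2k}$ and edges $(v_i,v_{i+j})$ for $i=0,\dots,2k-1$, $j=1,\dots,\min\{k,2k-i\}$, and let $R^{(k)}$ be the graph with vertices $v_1,\dots,v_{2k}$ and edges $(v_i,v_{i+j})$ for $i=1,\dots,2k-1$, $j=1,\dots,\min\{k,2k-i\}$. If $G\cong S^{(k)}$ or $G\cong R^{(k)}$, then there exists a labelling $f:E(G)\to\{ -1,0,1\}$ such that the values $wd(v)=\sum_{e\ni v}f(e)$, $v\in V(G)$, are pairwise distinct integers belonging to the set $\{0,1,2,\dots,|V(G)|-1\}$ when $k$ is even, and to the set $\{ -1,1,2,\dots,|V(G)|-1\}$ when $k$ is odd. -}

module Defs where

open import Data.Nat using (ℕ; zero; suc; _<_; _≤_; _+_; _*_; _<?_; _≤?_)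
open import Data.Nat.Divisibility using (_∣_)
open import Data.Fin using (Fin; toℕ)
open import Data.List using (List; foldr; map)
open import Data.List using (allFin) public
open import Data.Integer as ℤ using (ℤ; +_; -[1+_])
open import Data.Product using (Σ; _×_; _,_; ∃)
open import Relation.Binary.PropositionalEquality using (_≡_)
open import Relation.Nullary using (¬_; yes; no)
open import Data.Sum using (_⊎_)

data Sign : Set where
  neg zer pos : Sign

⟦_⟧ : Sign → ℤ
⟦ neg ⟧ = -[1+ 0 ]
⟦ zer ⟧ = + 0
⟦ pos ⟧ = + 1

-- The graph Band n k: vertices w_0,…,w_{n-1} (Fin n), and an edge {w_a, w_b}
-- for every a < b with b ≤ a + k.  An edge is represented once, as the
-- ordered pair (a , b) with a < b.
Edge : (n k : ℕ) → Set
Edge n k = Σ (Fin n) λ a → Σ (Fin n) λ b → (toℕ a < toℕ b) × (toℕ b ≤ toℕ a + k)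

contrib : {n k : ℕ} → (Edge n k → Sign) → (v u : Fin n) → ℤ
contrib {n} {k} f v u with toℕ v <? toℕ u | toℕ u ≤? toℕ v + k
... | yes p | yes q = ⟦ f (v , u , p , q) ⟧
... | yes _ | no _ = + 0
... | no _ | _ with toℕ u <? toℕ v | toℕ v ≤? toℕ u + k
...   | yes p | yes q = ⟦ f (u , v , p , q) ⟧
...   | _ | _ = + 0

wd : {n k : ℕ} → (Edge n k → Sign) → Fin n → ℤ
wd f v = foldr ℤ._+_ (+ 0) (map (contrib f v) (allFin _))

Allowed : (k n : ℕ) → ℤ → Set
Allowed k n z =
  (2 ∣ k → Σ ℕ λ m → (m < n) × (z ≡ + m)) ×
  (¬ (2 ∣ k) → (z ≡ -[1+ 0 ]) ⊎ (Σ ℕ λ m → (1 ≤ m) × (m < n) × (z ≡ + m)))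

GoodLabelling : (n k : ℕ) → Set
GoodLabelling n k =
  Σ (Edge n k → Sign) λ f →
    (∀ u v → wd f u ≡ wd f v → u ≡ v) × (∀ v → Allowed k n (wd f v))

-- S^(k) = Band (2k+1) k : vertices v_0,…,v_{2k} with v_i ↦ i; the edges
--   (v_i,v_{i+j}), 0 ≤ i ≤ 2k-1, 1 ≤ j ≤ min(k,2k-i), are exactly the pairs a<b≤2k with b-a ≤ k.
-- R^(k) = Band (2k) k : vertices v_1,…,v_{2k} with v_i ↦ i-1; same edge rule.

module Submission where

-- Put h = e + k with e ∈ {0,1}, so that Band (h + k) k is S^(k) for
-- e = 1 and R^(k) for e = 0.  Call the vertices x < h the bottom part and the
-- k vertices h + m (m < k) the top part; any two top vertices are adjacent.
-- A rainbow labelling gives +1 to every edge with an endpoint in the bottom part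
-- and, inside the top clique, -1 to the edges of an auxiliary graph N on
-- {0,…,k-1} and 0 to the others.  Counting neighbours gives
--     wd(x) = x + k                 for bottom vertices x < h,
--     wd(h + m) = (k - m) - deg_N m  for top vertices.
-- The bottom values fill {k,…,h+k-1}.  If N is a perfect matching (k = 2q, edges
-- m ~ m + q) the top values are k-1-m, i.e. {0,…,k-1}.  If k = 2q+1, take the
-- matching m ~ m + q + 1 (m < q) plus the edge q ~ 2q: then deg_N = 1 except
-- deg_N(2q) = 2, and the top values are {1,…,k-1} ∪ {-1}.

open import Defs
open import Data.Nat using (ℕ; _≤_; suc; _*_)
open import Data.Product using (_×_)
open import Data.Nat using (zero; _+_; _∸_; _<_; _<?_; _≤?_; _≟_; z≤n; s≤s)
open import Data.Nat.Properties
open import Data.Nat.Divisibility using (_∣_; divides; ∣m+n∣m⇒∣n; ∣1⇒≡1)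
import Data.Fin as Fin
open Fin using (Fin; toℕ)
open import Data.Fin.Properties using (toℕ-injective; toℕ<n)
open import Data.List using (foldr; tabulate)
open import Data.List.Properties using (map-tabulate)
open import Data.Integer using (ℤ; +_; -[1+_]; -_; _-_) renaming (_+_ to _+ᶻ_)
import Data.Integer.Properties as ℤP
open import Algebra.Properties.CommutativeSemigroup ℤP.+-commutativeSemigroup using (interchange)
open import Data.Product using (∃; _,_; proj₁; proj₂; swap)
open import Data.Sum using (_⊎_; inj₁; inj₂)
open import Function using (_∘_; id)
open import Relation.Binary.Definitions using (tri<; tri≈; tri>)
open import Relation.Binary.PropositionalEquality
open import Relation.Nullary using (Dec; yes; no; ¬_; contradiction)
open import Relation.Nullary.Decidable using (_⊎-dec_; _×-dec_)

𝟙 : {A : Set} → Dec A → ℤ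
𝟙 (yes _) = + 1
𝟙 (no _)  = + 0

𝟙-yes : {A : Set} (a? : Dec A) → A → 𝟙 a? ≡ + 1
𝟙-yes (yes _) _ = refl
𝟙-yes (no ¬a) a = contradiction a ¬a

𝟙-no : {A : Set} (a? : Dec A) → ¬ A → 𝟙 a? ≡ + 0
𝟙-no (yes a) ¬a = contradiction a ¬a
𝟙-no (no _)  _  = refl

𝟙-cong : {A B : Set} → (A → B) → (B → A) → (a? : Dec A) (b? : Dec B) → 𝟙 a? ≡ 𝟙 b?
𝟙-cong to _    (yes a)  b? = sym (𝟙-yes b? (to a))
𝟙-cong _  from (no ¬a) b? = sym (𝟙-no b? (¬a ∘ from))

𝟙-⊎ : {A B : Set} → ¬ (A × B) → (a? : Dec A) (b? : Dec B) → 𝟙 (a? ⊎-dec b?) ≡ 𝟙 a? +ᶻ 𝟙 b?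
𝟙-⊎ disj (yes a) (yes b) = contradiction (a , b) disj
𝟙-⊎ disj (yes _) (no _)  = refl
𝟙-⊎ disj (no _)  (yes _) = refl
𝟙-⊎ disj (no _)  (no _)  = refl

𝟙-<-≥ : ∀ m q → 𝟙 (m <? q) +ᶻ 𝟙 (q ≤? m) ≡ + 1
𝟙-<-≥ m q with m <? q
... | yes m<q rewrite 𝟙-no (q ≤? m) (<⇒≱ m<q) = refl
... | no m≮q  rewrite 𝟙-yes (q ≤? m) (≮⇒≥ m≮q) = refl

𝟙-trichotomy : ∀ m q → 𝟙 (m <? q) +ᶻ 𝟙 (m ≟ q) +ᶻ 𝟙 (q <? m) ≡ + 1
𝟙-trichotomy m q with <-cmp m q
... | tri< m<q m≢q _   rewrite 𝟙-yes (m <? q) m<q | 𝟙-no (m ≟ q) m≢q | 𝟙-no (q <? m) (<⇒≯ m<q) = refl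
... | tri≈ m≮q m≡q q≮m rewrite 𝟙-no (m <? q) m≮q | 𝟙-yes (m ≟ q) m≡q | 𝟙-no (q <? m) q≮m = refl
... | tri> m≮q m≢q q<m rewrite 𝟙-no (m <? q) m≮q | 𝟙-no (m ≟ q) m≢q | 𝟙-yes (q <? m) q<m = refl

∑ : ℕ → (ℕ → ℤ) → ℤ
∑ zero    g = + 0
∑ (suc n) g = g 0 +ᶻ ∑ n (g ∘ suc)

∑-cong : ∀ n {g g′ : ℕ → ℤ} → (∀ {y} → y < n → g y ≡ g′ y) → ∑ n g ≡ ∑ n g′
∑-cong zero    eq = refl
∑-cong (suc n) eq = cong₂ _+ᶻ_ (eq (s≤s z≤n)) (∑-cong n (eq ∘ s≤s))

∑-vanish : ∀ n {g : ℕ → ℤ} → (∀ {y} → y < n → g y ≡ + 0) → ∑ n g ≡ + 0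
∑-vanish zero    eq = refl
∑-vanish (suc n) eq = cong₂ _+ᶻ_ (eq (s≤s z≤n)) (∑-vanish n (eq ∘ s≤s))

∑-+ : ∀ n (g g′ : ℕ → ℤ) → ∑ n (λ y → g y +ᶻ g′ y) ≡ ∑ n g +ᶻ ∑ n g′
∑-+ zero    g g′ = refl
∑-+ (suc n) g g′ = trans (cong ((g 0 +ᶻ g′ 0) +ᶻ_) (∑-+ n (g ∘ suc) (g′ ∘ suc)))
                         (interchange (g 0) (g′ 0) (∑ n (g ∘ suc)) (∑ n (g′ ∘ suc)))

∑-neg : ∀ n (g : ℕ → ℤ) → ∑ n (λ y → - g y) ≡ - ∑ n g
∑-neg zero    g = refl
∑-neg (suc n) g = trans (cong (- g 0 +ᶻ_) (∑-neg n (g ∘ suc))) (sym (ℤP.neg-distrib-+ (g 0) _))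

∑-- : ∀ n (g g′ : ℕ → ℤ) → ∑ n (λ y → g y - g′ y) ≡ ∑ n g - ∑ n g′
∑-- n g g′ = trans (∑-+ n g (-_ ∘ g′)) (cong (∑ n g +ᶻ_) (∑-neg n g′))

∑-split : ∀ m n (g : ℕ → ℤ) → ∑ (m + n) g ≡ ∑ m g +ᶻ ∑ n (λ y → g (m + y))
∑-split zero    n g = sym (ℤP.+-identityˡ _)
∑-split (suc m) n g = trans (cong (g 0 +ᶻ_) (∑-split m n (g ∘ suc))) (sym (ℤP.+-assoc (g 0) _ _))

∑-< : ∀ {n t} → t ≤ n → ∑ n (λ y → 𝟙 (y <? t)) ≡ + t
∑-< {zero}  z≤n = refl
∑-< {suc n} {zero} _ = ∑-vanish (suc n) (λ {y} _ → 𝟙-no (y <? 0) λ ())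
∑-< {suc n} {suc t} (s≤s t≤n) =
  cong (+ 1 +ᶻ_) (trans (∑-cong n (λ {y} _ → 𝟙-cong ≤-pred s≤s (suc y <? suc t) (y <? t))) (∑-< t≤n))

∑-≥ : ∀ n t → ∑ n (λ y → 𝟙 (t ≤? y)) ≡ + (n ∸ t)
∑-≥ zero    zero    = refl
∑-≥ zero    (suc t) = refl
∑-≥ (suc n) zero    =
  cong (+ 1 +ᶻ_) (trans (∑-cong n (λ {y} _ → 𝟙-cong (λ _ → z≤n) (λ _ → z≤n) (0 ≤? suc y) (0 ≤? y))) (∑-≥ n 0))
∑-≥ (suc n) (suc t) =
  trans (ℤP.+-identityˡ _) (trans (∑-cong n (λ {y} _ → 𝟙-cong ≤-pred s≤s (suc t ≤? suc y) (t ≤? y))) (∑-≥ n t))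

∑-δ : ∀ n p → ∑ n (λ y → 𝟙 (y ≟ p)) ≡ 𝟙 (p <? n)
∑-δ zero    p       = sym (𝟙-no (p <? 0) λ ())
∑-δ (suc n) zero    = cong (+ 1 +ᶻ_) (∑-vanish n (λ {y} _ → 𝟙-no (suc y ≟ 0) λ ()))
∑-δ (suc n) (suc p) = trans (ℤP.+-identityˡ _)
  (trans (∑-cong n (λ {y} _ → 𝟙-cong suc-injective (cong suc) (suc y ≟ suc p) (y ≟ p)))
         (trans (∑-δ n p) (𝟙-cong s≤s ≤-pred (p <? n) (suc p <? suc n))))

∑-δ-shift : ∀ {n m} s → m < n → ∑ n (λ y → 𝟙 (m ≟ y + s)) ≡ 𝟙 (s ≤? m)
∑-δ-shift {n} {m} s m<n with s ≤? m
... | yes s≤m = begin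
  ∑ n (λ y → 𝟙 (m ≟ y + s))  ≡⟨ ∑-cong n (λ {y} _ → 𝟙-cong to from (m ≟ y + s) (y ≟ m ∸ s)) ⟩
  ∑ n (λ y → 𝟙 (y ≟ m ∸ s))  ≡⟨ ∑-δ n (m ∸ s) ⟩
  𝟙 (m ∸ s <? n)             ≡⟨ 𝟙-yes (m ∸ s <? n) (≤-<-trans (m∸n≤m m s) m<n) ⟩
  + 1                        ∎
  where
  open ≡-Reasoning
  to : ∀ {y} → m ≡ y + s → y ≡ m ∸ s
  to {y} refl = sym (m+n∸n≡m y s)
  from : ∀ {y} → y ≡ m ∸ s → m ≡ y + s
  from refl = sym (trans (+-comm (m ∸ s) s) (m+[n∸m]≡n s≤m))
... | no s≰m = ∑-vanish n (λ {y} _ → 𝟙-no (m ≟ y + s) λ m≡y+s → s≰m (subst (s ≤_) (sym m≡y+s) (m≤n+m s _)))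

∑-δ× : ∀ {A : Set} n {p} → p < n → (a? : Dec A) → ∑ n (λ y → 𝟙 (a? ×-dec (y ≟ p))) ≡ 𝟙 a?
∑-δ× n {p} p<n (yes a) = begin
  ∑ n (λ y → 𝟙 (yes a ×-dec (y ≟ p)))  ≡⟨ ∑-cong n (λ {y} _ → 𝟙-cong proj₂ (a ,_) (yes a ×-dec (y ≟ p)) (y ≟ p)) ⟩
  ∑ n (λ y → 𝟙 (y ≟ p))                ≡⟨ ∑-δ n p ⟩
  𝟙 (p <? n)                           ≡⟨ 𝟙-yes (p <? n) p<n ⟩
  + 1                                  ∎
  where open ≡-Reasoning
∑-δ× n {p} p<n (no ¬a) = ∑-vanish n (λ {y} _ → 𝟙-no (no ¬a ×-dec (y ≟ p)) (¬a ∘ proj₁))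

module Band (k : ℕ) (L : ℕ → ℕ → Sign) where

  induced : ∀ {n} → Edge n k → Sign
  induced (a , b , _) = L (toℕ a) (toℕ b)

  weight : ℕ → ℕ → ℤ
  weight x y with x <? y | y ≤? x + k
  ... | yes _ | yes _ = ⟦ L x y ⟧
  ... | yes _ | no _  = + 0
  ... | no _  | _ with y <? x | x ≤? y + k
  ...   | yes _ | yes _ = ⟦ L y x ⟧
  ...   | _     | _     = + 0

  contrib≡weight : ∀ {n} (v u : Fin n) → contrib induced v u ≡ weight (toℕ v) (toℕ u)
  contrib≡weight v u with toℕ v <? toℕ u | toℕ u ≤? toℕ v + k
  ... | yes _ | yes _ = refl
  ... | yes _ | no _  = refl
  ... | no _  | _ with toℕ u <? toℕ v | toℕ v ≤? toℕ u + k
  ...   | yes _ | yes _ = refl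
  ...   | yes _ | no _  = refl
  ...   | no _  | _     = refl

  wd≡∑ : ∀ {n} (v : Fin n) → wd induced v ≡ ∑ n (weight (toℕ v))
  wd≡∑ {n} v = trans (cong (foldr _+ᶻ_ (+ 0)) (map-tabulate id (contrib induced v)))
                     (sum-tabulate n (contrib induced v) (weight (toℕ v)) (contrib≡weight v))
    where
    sum-tabulate : ∀ n (g : Fin n → ℤ) (G : ℕ → ℤ) → (∀ i → g i ≡ G (toℕ i)) →
                   foldr _+ᶻ_ (+ 0) (tabulate g) ≡ ∑ n G
    sum-tabulate zero    g G eq = refl
    sum-tabulate (suc n) g G eq =
      cong₂ _+ᶻ_ (eq Fin.zero) (sum-tabulate n (g ∘ Fin.suc) (G ∘ suc) (eq ∘ Fin.suc))

  weight-up : ∀ {x y} → x < y → y ≤ x + k → weight x y ≡ ⟦ L x y ⟧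
  weight-up {x} {y} x<y y≤x+k with x <? y | y ≤? x + k
  ... | yes _  | yes _      = refl
  ... | yes _  | no y≰x+k   = contradiction y≤x+k y≰x+k
  ... | no x≮y | _          = contradiction x<y x≮y

  weight-up-far : ∀ {x y} → x < y → ¬ y ≤ x + k → weight x y ≡ + 0
  weight-up-far {x} {y} x<y y≰x+k with x <? y | y ≤? x + k
  ... | yes _  | yes y≤x+k = contradiction y≤x+k y≰x+k
  ... | yes _  | no _      = refl
  ... | no x≮y | _         = contradiction x<y x≮y

  weight-down : ∀ {x y} → y < x → x ≤ y + k → weight x y ≡ ⟦ L y x ⟧
  weight-down {x} {y} y<x x≤y+k with x <? y
  ... | yes x<y = contradiction x<y (<⇒≯ y<x)
  ... | no _ with y <? x | x ≤? y + k
  ...   | yes _  | yes _    = refl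
  ...   | yes _  | no x≰y+k = contradiction x≤y+k x≰y+k
  ...   | no y≮x | _        = contradiction y<x y≮x

  weight-down-far : ∀ {x y} → y < x → ¬ x ≤ y + k → weight x y ≡ + 0
  weight-down-far {x} {y} y<x x≰y+k with x <? y
  ... | yes x<y = contradiction x<y (<⇒≯ y<x)
  ... | no _ with y <? x | x ≤? y + k
  ...   | yes _ | yes x≤y+k = contradiction x≤y+k x≰y+k
  ...   | yes _ | no _      = refl
  ...   | no _  | _         = refl

  weight-self : ∀ x → weight x x ≡ + 0
  weight-self x with x <? x
  ... | yes x<x = contradiction x<x (<-irrefl refl)
  ... | no _ with x <? x
  ...   | yes x<x = contradiction x<x (<-irrefl refl)
  ...   | no _    = refl

-- Degrees in an auxiliary graph on {0,…,k-1}: the edges are the pairs i < j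
-- with P i j, so the degree of m counts both the j with P m j and those with P j m.

degree : {P : ℕ → ℕ → Set} → (∀ i j → Dec (P i j)) → ℕ → ℕ → ℤ
degree P? k m = ∑ k (λ j → 𝟙 (P? m j) +ᶻ 𝟙 (P? j m))

degree-⊎ : {P Q : ℕ → ℕ → Set} (P? : ∀ i j → Dec (P i j)) (Q? : ∀ i j → Dec (Q i j)) →
           (∀ {i j} → ¬ (P i j × Q i j)) → ∀ k m →
           degree (λ i j → P? i j ⊎-dec Q? i j) k m ≡ degree P? k m +ᶻ degree Q? k m
degree-⊎ P? Q? disjoint k m = begin
  ∑ k (λ j → 𝟙 (P? m j ⊎-dec Q? m j) +ᶻ 𝟙 (P? j m ⊎-dec Q? j m))
    ≡⟨ ∑-cong k (λ {j} _ → trans (cong₂ _+ᶻ_ (𝟙-⊎ disjoint (P? m j) (Q? m j)) (𝟙-⊎ disjoint (P? j m) (Q? j m)))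
                                 (interchange (𝟙 (P? m j)) (𝟙 (Q? m j)) (𝟙 (P? j m)) (𝟙 (Q? j m)))) ⟩
  ∑ k (λ j → (𝟙 (P? m j) +ᶻ 𝟙 (P? j m)) +ᶻ (𝟙 (Q? m j) +ᶻ 𝟙 (Q? j m)))
    ≡⟨ ∑-+ k _ _ ⟩
  degree P? k m +ᶻ degree Q? k m ∎
  where open ≡-Reasoning

shift? : (s i j : ℕ) → Dec (j ≡ i + s)
shift? s i j = j ≟ i + s

-- m has the neighbour m + s if it is in range, and m ∸ s if s ≤ m
degree-shift : ∀ {k m} s → m < k → degree (shift? s) k m ≡ 𝟙 (m + s <? k) +ᶻ 𝟙 (s ≤? m)
degree-shift {k} {m} s m<k = trans (∑-+ k _ _) (cong₂ _+ᶻ_ (∑-δ k (m + s)) (∑-δ-shift s m<k))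

single? : (a b i j : ℕ) → Dec (i ≡ a × j ≡ b)
single? a b i j = (i ≟ a) ×-dec (j ≟ b)

degree-single : ∀ {k a b} m → a < k → b < k → degree (single? a b) k m ≡ 𝟙 (m ≟ a) +ᶻ 𝟙 (m ≟ b)
degree-single {k} {a} {b} m a<k b<k = begin
  degree (single? a b) k m
    ≡⟨ ∑-+ k _ _ ⟩
  ∑ k (λ j → 𝟙 ((m ≟ a) ×-dec (j ≟ b))) +ᶻ ∑ k (λ j → 𝟙 ((j ≟ a) ×-dec (m ≟ b)))
    ≡⟨ cong (∑ k (λ j → 𝟙 ((m ≟ a) ×-dec (j ≟ b))) +ᶻ_)
            (∑-cong k (λ {j} _ → 𝟙-cong swap swap ((j ≟ a) ×-dec (m ≟ b)) ((m ≟ b) ×-dec (j ≟ a)))) ⟩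
  ∑ k (λ j → 𝟙 ((m ≟ a) ×-dec (j ≟ b))) +ᶻ ∑ k (λ j → 𝟙 ((m ≟ b) ×-dec (j ≟ a)))
    ≡⟨ cong₂ _+ᶻ_ (∑-δ× k b<k (m ≟ a)) (∑-δ× k a<k (m ≟ b)) ⟩
  𝟙 (m ≟ a) +ᶻ 𝟙 (m ≟ b) ∎
  where open ≡-Reasoning

allowed-pos : ∀ {k n j} → 1 ≤ j → j < n → Allowed k n (+ j)
allowed-pos 1≤j j<n = (λ _ → _ , j<n , refl) , (λ _ → inj₂ (_ , 1≤j , j<n , refl))

allowed-even : ∀ {k n j} → 2 ∣ k → j < n → Allowed k n (+ j)
allowed-even 2∣k j<n = (λ _ → _ , j<n , refl) , (λ 2∤k → contradiction 2∣k 2∤k)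

allowed-minus-one : ∀ {k n} → ¬ 2 ∣ k → Allowed k n -[1+ 0 ]
allowed-minus-one 2∤k = (λ 2∣k → contradiction 2∣k 2∤k) , (λ _ → inj₁ refl)

negIf : {A : Set} → Dec A → Sign
negIf (yes _) = neg
negIf (no _)  = zer

⟦negIf⟧ : {A : Set} (a? : Dec A) → ⟦ negIf a? ⟧ ≡ - 𝟙 a?
⟦negIf⟧ (yes _) = refl
⟦negIf⟧ (no _)  = refl

module Rainbow (e k : ℕ) {P : ℕ → ℕ → Set} (P? : ∀ i j → Dec (P i j))
               (P-increasing : ∀ {i j} → P i j → i < j) where

  h n : ℕ
  h = e + k
  n = h + k

  rainbow : ℕ → ℕ → Sign
  rainbow a b with a <? h
  ... | yes _ = pos
  ... | no _  = negIf (P? (a ∸ h) (b ∸ h))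

  open Band k rainbow

  rainbow-bottom : ∀ {a b} → a < h → rainbow a b ≡ pos
  rainbow-bottom {a} a<h with a <? h
  ... | yes _  = refl
  ... | no a≮h = contradiction a<h a≮h

  rainbow-top : ∀ i j → ⟦ rainbow (h + i) (h + j) ⟧ ≡ - 𝟙 (P? i j)
  rainbow-top i j with h + i <? h
  ... | yes h+i<h = contradiction h+i<h (≤⇒≯ (m≤m+n h i))
  ... | no _ rewrite m+n∸m≡n h i | m+n∸m≡n h j = ⟦negIf⟧ (P? i j)

  -- Bottom vertices.  As x < h ≤ k + 1, the vertex x is adjacent to all y < x
  -- and to x + 1, …, x + k; all these edges carry +1.
  module _ (e≤1 : e ≤ 1) where

    bottom-≤k : ∀ {x} → x < h → x ≤ k
    bottom-≤k x<h = ≤-pred (≤-trans x<h (+-monoˡ-≤ k e≤1))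

    weight-bottom : ∀ {x} → x < h → ∀ y → weight x y ≡ 𝟙 (y <? suc (x + k)) - 𝟙 (y ≟ x)
    weight-bottom {x} x<h y with <-cmp x y
    ... | tri< x<y _ _ with ≤-<-connex y (x + k)
    ...   | inj₁ y≤x+k rewrite weight-up x<y y≤x+k | rainbow-bottom {b = y} x<h
                            | 𝟙-yes (y <? suc (x + k)) (s≤s y≤x+k) | 𝟙-no (y ≟ x) (>⇒≢ x<y) = refl
    ...   | inj₂ x+k<y rewrite weight-up-far x<y (<⇒≱ x+k<y)
                            | 𝟙-no (y <? suc (x + k)) (<⇒≱ x+k<y ∘ ≤-pred) | 𝟙-no (y ≟ x) (>⇒≢ x<y) = refl
    weight-bottom {x} x<h y | tri≈ _ refl _
      rewrite weight-self x | 𝟙-yes (x <? suc (x + k)) (s≤s (m≤m+n x k)) | 𝟙-yes (x ≟ x) refl = refl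
    weight-bottom {x} x<h y | tri> _ _ y<x
      rewrite weight-down y<x (≤-trans (bottom-≤k x<h) (m≤n+m k y)) | rainbow-bottom {b = x} (<-trans y<x x<h)
            | 𝟙-yes (y <? suc (x + k)) (s≤s (≤-trans (<⇒≤ y<x) (m≤m+n x k))) | 𝟙-no (y ≟ x) (<⇒≢ y<x) = refl

    wd-bottom : ∀ {x} → x < h → ∑ n (weight x) ≡ + (x + k)
    wd-bottom {x} x<h = begin
      ∑ n (weight x)
        ≡⟨ ∑-cong n (λ {y} _ → weight-bottom x<h y) ⟩
      ∑ n (λ y → 𝟙 (y <? suc (x + k)) - 𝟙 (y ≟ x))
        ≡⟨ ∑-- n _ _ ⟩
      ∑ n (λ y → 𝟙 (y <? suc (x + k))) - ∑ n (λ y → 𝟙 (y ≟ x))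
        ≡⟨ cong₂ _-_ (∑-< (+-monoˡ-≤ k x<h))
                     (trans (∑-δ n x) (𝟙-yes (x <? n) (<-≤-trans x<h (m≤m+n h k)))) ⟩
      + suc (x + k) - + 1
        ≡⟨⟩
      + (x + k) ∎
      where open ≡-Reasoning

  -- Top vertices.  h + m is adjacent to the bottom vertices y ≥ e + m (edges
  -- labelled +1) and to every other top vertex.

  -- h + m ≤ y + k  iff  e + m ≤ y
  top-shift : ∀ m → h + m ≡ (e + m) + k
  top-shift m = trans (+-assoc e k m) (trans (cong (λ z → e + z) (+-comm k m)) (sym (+-assoc e m k)))

  weight-top-bottom : ∀ m {y} → y < h → weight (h + m) y ≡ 𝟙 (e + m ≤? y)
  weight-top-bottom m {y} y<h with e + m ≤? y
  ... | yes e+m≤y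
    rewrite weight-down (<-≤-trans y<h (m≤m+n h m)) (subst (_≤ y + k) (sym (top-shift m)) (+-monoˡ-≤ k e+m≤y))
          | rainbow-bottom {b = h + m} y<h = refl
  ... | no e+m≰y = weight-down-far (<-≤-trans y<h (m≤m+n h m))
                                   (e+m≰y ∘ +-cancelʳ-≤ k (e + m) y ∘ subst (_≤ y + k) (top-shift m))

  top-adjacent : ∀ {i} m → i < k → h + i ≤ (h + m) + k
  top-adjacent m i<k = ≤-trans (+-monoʳ-≤ h (<⇒≤ i<k)) (+-monoˡ-≤ k (m≤m+n h m))

  weight-top-top : ∀ {m j} → m < k → j < k → weight (h + m) (h + j) ≡ - (𝟙 (P? m j) +ᶻ 𝟙 (P? j m))
  weight-top-top {m} {j} m<k j<k with <-cmp m j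
  ... | tri< m<j _ _ rewrite weight-up (+-monoʳ-< h m<j) (top-adjacent m j<k) | rainbow-top m j
        | 𝟙-no (P? j m) (<⇒≯ m<j ∘ P-increasing) | ℤP.+-identityʳ (𝟙 (P? m j)) = refl
  ... | tri≈ _ refl _ rewrite weight-self (h + m) | 𝟙-no (P? m m) (<-irrefl refl ∘ P-increasing) = refl
  ... | tri> _ _ j<m rewrite weight-down (+-monoʳ-< h j<m) (top-adjacent j m<k) | rainbow-top j m
        | 𝟙-no (P? m j) (<⇒≯ j<m ∘ P-increasing) | ℤP.+-identityˡ (𝟙 (P? j m)) = refl

  wd-top : ∀ {m} → m < k → ∑ n (weight (h + m)) ≡ + (k ∸ m) - degree P? k m
  wd-top {m} m<k = begin
    ∑ (h + k) (weight (h + m))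
      ≡⟨ ∑-split h k _ ⟩
    ∑ h (weight (h + m)) +ᶻ ∑ k (λ j → weight (h + m) (h + j))
      ≡⟨ cong₂ _+ᶻ_ (∑-cong h (weight-top-bottom m)) (∑-cong k (weight-top-top m<k)) ⟩
    ∑ h (λ y → 𝟙 (e + m ≤? y)) +ᶻ ∑ k (λ j → - (𝟙 (P? m j) +ᶻ 𝟙 (P? j m)))
      ≡⟨ cong₂ _+ᶻ_ (∑-≥ h (e + m)) (∑-neg k _) ⟩
    + (h ∸ (e + m)) - degree P? k m
      ≡⟨ cong (λ d → + d - degree P? k m) ([m+n]∸[m+o]≡n∸o e k m) ⟩
    + (k ∸ m) - degree P? k m ∎
    where open ≡-Reasoning

  bottom-or-top : ∀ {x} → x < n → x < h ⊎ ∃ λ m → m < k × x ≡ h + m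
  bottom-or-top {x} x<n with x <? h
  ... | yes x<h = inj₁ x<h
  ... | no x≮h  = inj₂ (x ∸ h , +-cancelˡ-< h (x ∸ h) k (subst (_< n) (sym h+[x∸h]≡x) x<n) , sym h+[x∸h]≡x)
    where
    h+[x∸h]≡x : h + (x ∸ h) ≡ x
    h+[x∸h]≡x = m+[n∸m]≡n (≮⇒≥ x≮h)

  -- Good labelling criterion: the bottom values x + k are distinct, allowed and
  -- at least k, so it suffices that the top values τ m are distinct, allowed and
  -- below k.
  module _ (e≤1 : e ≤ 1) (0<k : 0 < k) (τ : ℕ → ℤ)
           (top-value : ∀ {m} → m < k → + (k ∸ m) - degree P? k m ≡ τ m)
           (τ-injective : ∀ {m m′} → m < k → m′ < k → τ m ≡ τ m′ → m ≡ m′)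
           (τ-below-k : ∀ {m j} → m < k → τ m ≡ + j → j < k)
           (τ-allowed : ∀ {m} → m < k → Allowed k n (τ m)) where

    wd-τ : ∀ {m} → m < k → ∑ n (weight (h + m)) ≡ τ m
    wd-τ m<k = trans (wd-top m<k) (top-value m<k)

    bottom≢top : ∀ {x m} → x < h → m < k → ∑ n (weight x) ≢ ∑ n (weight (h + m))
    bottom≢top {x} x<h m<k eq =
      <⇒≱ (τ-below-k m<k (trans (sym (wd-τ m<k)) (trans (sym eq) (wd-bottom e≤1 x<h)))) (m≤n+m k x)

    value-injective : ∀ {x y} → x < n → y < n → ∑ n (weight x) ≡ ∑ n (weight y) → x ≡ y
    value-injective x<n y<n eq with bottom-or-top x<n | bottom-or-top y<n
    ... | inj₁ x<h | inj₁ y<h =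
      +-cancelʳ-≡ k _ _ (ℤP.+-injective (trans (sym (wd-bottom e≤1 x<h)) (trans eq (wd-bottom e≤1 y<h))))
    ... | inj₁ x<h | inj₂ (m , m<k , refl) = contradiction eq (bottom≢top x<h m<k)
    ... | inj₂ (m , m<k , refl) | inj₁ y<h = contradiction (sym eq) (bottom≢top y<h m<k)
    ... | inj₂ (m , m<k , refl) | inj₂ (m′ , m′<k , refl) =
      cong (λ m → h + m) (τ-injective m<k m′<k (trans (sym (wd-τ m<k)) (trans eq (wd-τ m′<k))))

    value-allowed : ∀ {x} → x < n → Allowed k n (∑ n (weight x))
    value-allowed x<n with bottom-or-top x<n
    ... | inj₁ x<h = subst (Allowed k n) (sym (wd-bottom e≤1 x<h))
                           (allowed-pos (≤-trans 0<k (m≤n+m k _)) (+-monoˡ-< k x<h))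
    ... | inj₂ (m , m<k , refl) = subst (Allowed k n) (sym (wd-τ m<k)) (τ-allowed m<k)

    good : GoodLabelling n k
    good = induced
         , (λ u v eq → toℕ-injective (value-injective (toℕ<n u) (toℕ<n v)
                                       (trans (sym (wd≡∑ u)) (trans eq (wd≡∑ v)))))
         , (λ v → subst (Allowed k n) (sym (wd≡∑ v)) (value-allowed (toℕ<n v)))

parity : ∀ k → ∃ λ q → k ≡ q + q ⊎ k ≡ suc (q + q)
parity zero    = 0 , inj₁ refl
parity (suc k) with parity k
... | q , inj₁ refl = q , inj₂ refl
... | q , inj₂ refl = suc q , inj₁ (cong suc (sym (+-suc q q)))

even-divisible : ∀ q → 2 ∣ q + q
even-divisible q = divides q (trans (cong (λ z → q + z) (sym (+-identityʳ q))) (*-comm 2 q))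

odd-indivisible : ∀ q → ¬ 2 ∣ suc (q + q)
odd-indivisible q 2∣odd = contradiction (∣1⇒≡1 (∣m+n∣m⇒∣n (subst (2 ∣_) (+-comm 1 (q + q)) 2∣odd) (even-divisible q)))
                                        λ ()

countdown-step : ∀ {k m} → m < k → + (k ∸ m) - + 1 ≡ + (k ∸ suc m)
countdown-step {suc k} {zero}  _         = refl
countdown-step {suc k} {suc m} (s≤s m<k) = countdown-step m<k

countdown-injective : ∀ {k m m′} → m < k → m′ < k → + (k ∸ suc m) ≡ + (k ∸ suc m′) → m ≡ m′
countdown-injective m<k m′<k eq = suc-injective (∸-cancelˡ-≡ m<k m′<k (ℤP.+-injective eq))

countdown-below : ∀ {k m j} → m < k → + (k ∸ suc m) ≡ + j → j < k
countdown-below m<k eq = subst (_< _) (ℤP.+-injective eq) (∸-monoʳ-< (s≤s z≤n) m<k)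

module EvenBand (q : ℕ) (0<q : 0 < q) (e : ℕ) (e≤1 : e ≤ 1) where

  k : ℕ
  k = q + q

  shift-increasing : ∀ {i j} → j ≡ i + q → i < j
  shift-increasing {i} refl = m<m+n i 0<q

  open Rainbow e k (shift? q) shift-increasing

  degree-matching : ∀ {m} → m < k → degree (shift? q) k m ≡ + 1
  degree-matching {m} m<k = begin
    degree (shift? q) k m           ≡⟨ degree-shift q m<k ⟩
    𝟙 (m + q <? k) +ᶻ 𝟙 (q ≤? m)    ≡⟨ cong (_+ᶻ 𝟙 (q ≤? m)) (𝟙-cong (+-cancelʳ-< q m q) (+-monoˡ-< q) (m + q <? k) (m <? q)) ⟩
    𝟙 (m <? q) +ᶻ 𝟙 (q ≤? m)        ≡⟨ 𝟙-<-≥ m q ⟩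
    + 1                             ∎
    where open ≡-Reasoning

  good-even : 2 ∣ k → GoodLabelling n k
  good-even 2∣k = good e≤1 (≤-trans 0<q (m≤m+n q q)) (λ m → + (k ∸ suc m))
    (λ {m} m<k → trans (cong (λ d → + (k ∸ m) - d) (degree-matching m<k)) (countdown-step m<k))
    countdown-injective countdown-below
    (λ m<k → allowed-even 2∣k (<-≤-trans (∸-monoʳ-< (s≤s z≤n) m<k) (m≤n+m k h)))

-- Every top vertex has degree 1 except h + 2q,
-- which has degree 2 and therefore gets the value -1 instead of 0.

module OddBand (q : ℕ) (0<q : 0 < q) (e : ℕ) (e≤1 : e ≤ 1) where

  k : ℕ
  k = suc (q + q)

  N? : ∀ i j → Dec (j ≡ i + suc q ⊎ (i ≡ q × j ≡ q + q))
  N? i j = shift? (suc q) i j ⊎-dec single? q (q + q) i j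

  N-increasing : ∀ {i j} → j ≡ i + suc q ⊎ (i ≡ q × j ≡ q + q) → i < j
  N-increasing {i} (inj₁ refl)         = m<m+n i (s≤s z≤n)
  N-increasing     (inj₂ (refl , refl)) = m<m+n q 0<q

  -- q + q = q + suc q is impossible, so the edge q ~ q + q is not a shift edge
  shift-single-disjoint : ∀ {i j} → ¬ (j ≡ i + suc q × (i ≡ q × j ≡ q + q))
  shift-single-disjoint (q+q≡q+suc-q , refl , refl) = 1+n≢n (sym (trans q+q≡q+suc-q (+-suc q q)))

  open Rainbow e k N? N-increasing

  degree-N : ∀ {m} → m < k → degree N? k m ≡ + 1 +ᶻ 𝟙 (m ≟ q + q)
  degree-N {m} m<k = begin
    degree N? k m
      ≡⟨ degree-⊎ (shift? (suc q)) (single? q (q + q)) shift-single-disjoint k m ⟩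
    degree (shift? (suc q)) k m +ᶻ degree (single? q (q + q)) k m
      ≡⟨ cong₂ _+ᶻ_ (degree-shift (suc q) m<k) (degree-single m (s≤s (m≤m+n q q)) ≤-refl) ⟩
    (𝟙 (m + suc q <? k) +ᶻ 𝟙 (q <? m)) +ᶻ (𝟙 (m ≟ q) +ᶻ 𝟙 (m ≟ q + q))
      ≡⟨ cong (λ a → (a +ᶻ 𝟙 (q <? m)) +ᶻ (𝟙 (m ≟ q) +ᶻ 𝟙 (m ≟ q + q)))
              (𝟙-cong (+-cancelʳ-< (suc q) m q ∘ subst (m + suc q <_) (sym (+-suc q q)))
                      (subst (m + suc q <_) (+-suc q q) ∘ +-monoˡ-< (suc q)) (m + suc q <? k) (m <? q)) ⟩
    (𝟙 (m <? q) +ᶻ 𝟙 (q <? m)) +ᶻ (𝟙 (m ≟ q) +ᶻ 𝟙 (m ≟ q + q))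
      ≡⟨ interchange (𝟙 (m <? q)) (𝟙 (q <? m)) (𝟙 (m ≟ q)) (𝟙 (m ≟ q + q)) ⟩
    (𝟙 (m <? q) +ᶻ 𝟙 (m ≟ q)) +ᶻ (𝟙 (q <? m) +ᶻ 𝟙 (m ≟ q + q))
      ≡⟨ sym (ℤP.+-assoc (𝟙 (m <? q) +ᶻ 𝟙 (m ≟ q)) (𝟙 (q <? m)) (𝟙 (m ≟ q + q))) ⟩
    (𝟙 (m <? q) +ᶻ 𝟙 (m ≟ q) +ᶻ 𝟙 (q <? m)) +ᶻ 𝟙 (m ≟ q + q)
      ≡⟨ cong (_+ᶻ 𝟙 (m ≟ q + q)) (𝟙-trichotomy m q) ⟩
    + 1 +ᶻ 𝟙 (m ≟ q + q) ∎
    where open ≡-Reasoning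

  τ : ℕ → ℤ
  τ m with m ≟ q + q
  ... | yes _ = -[1+ 0 ]
  ... | no _  = + (k ∸ suc m)

  top-value : ∀ {m} → m < k → + (k ∸ m) - (+ 1 +ᶻ 𝟙 (m ≟ q + q)) ≡ τ m
  top-value {m} m<k with m ≟ q + q
  ... | yes refl rewrite m+n∸n≡m 1 (q + q) = refl
  ... | no _     = countdown-step m<k

  τ-injective : ∀ {m m′} → m < k → m′ < k → τ m ≡ τ m′ → m ≡ m′
  τ-injective {m} {m′} m<k m′<k eq with m ≟ q + q | m′ ≟ q + q
  ... | yes m≡2q | yes m′≡2q = trans m≡2q (sym m′≡2q)
  ... | no _     | no _      = countdown-injective m<k m′<k eq
  τ-injective _ _ () | yes _ | no _
  τ-injective _ _ () | no _  | yes _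

  τ-below-k : ∀ {m j} → m < k → τ m ≡ + j → j < k
  τ-below-k {m} m<k eq with m ≟ q + q
  τ-below-k _ () | yes _
  ... | no _ = countdown-below m<k eq

  τ-allowed : ∀ {m} → m < k → Allowed k n (τ m)
  τ-allowed {m} m<k with m ≟ q + q
  ... | yes _   = allowed-minus-one (odd-indivisible q)
  ... | no m≢2q = allowed-pos (m<n⇒0<n∸m (s≤s (≤∧≢⇒< (≤-pred m<k) m≢2q)))
                              (<-≤-trans (∸-monoʳ-< (s≤s z≤n) m<k) (m≤n+m k h))

  good-odd : GoodLabelling n k
  good-odd = good e≤1 (s≤s z≤n) τ
    (λ {m} m<k → trans (cong (λ d → + (k ∸ m) - d) (degree-N m<k)) (top-value m<k))
    τ-injective τ-below-k τ-allowed

halve : ∀ k → 2 ≤ k → ∃ λ q → 0 < q × (k ≡ q + q ⊎ k ≡ suc (q + q))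
halve k 2≤k with parity k
... | zero  , inj₁ refl = contradiction 2≤k λ ()
... | zero  , inj₂ refl = contradiction 2≤k λ { (s≤s ()) }
... | suc q , k≡        = suc q , s≤s z≤n , k≡

-- The rainbow labellings live on (1 + k) + k = |S^(k)| and (0 + k) + k = |R^(k)| vertices.
S-and-R : ∀ {k} → GoodLabelling (suc (k + k)) k → GoodLabelling (k + k) k →
          GoodLabelling (suc (2 * k)) k × GoodLabelling (2 * k) k
S-and-R {k} S R = subst (λ n → GoodLabelling n k) (cong suc k+k≡2k) S
                , subst (λ n → GoodLabelling n k) k+k≡2k R
  where
  k+k≡2k : k + k ≡ 2 * k
  k+k≡2k = cong (λ z → k + z) (sym (+-identityʳ k))

lemma3p3 : (k : ℕ) → 2 ≤ k → GoodLabelling (suc (2 * k)) k × GoodLabelling (2 * k) k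
lemma3p3 k 2≤k with halve k 2≤k
... | q , 0<q , inj₁ refl = S-and-R (EvenBand.good-even q 0<q 1 ≤-refl (even-divisible q))
                                    (EvenBand.good-even q 0<q 0 z≤n (even-divisible q))
... | q , 0<q , inj₂ refl = S-and-R (OddBand.good-odd q 0<q 1 ≤-refl)
                                    (OddBand.good-odd q 0<q 0 z≤n)
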